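{- Let $(i,j)$ be a position pair (with $i$ a position of $S$ and $j$ a position of $S'$) such that $\{(i+l,j+l):0\le l\le k-1\}\cap P_H=\emptyset$. Then $\Pr(A(i,j)=1)=\frac{1}{\sigma^k}$.
   Context: Let $\Sigma$ be an alphabet of size $\sigma$. Let $S$ be a length-$n$ string with letters i.i.d. uniform on $\Sigma$. Fix $p\ge0$, $m'$ with $p+m'\le n$. $S'$ is obtained from $S[p+1:p+m']$ by the channel: independently for each position $p+j$, independently (i) with probability $\theta_s$ substitution by a uniformly chosen different letter; (ii) with probability $\theta_d$ deletion; (iii) with probability $\theta_i$ insertion immediately to its left of a string of i.i.d. uniform letters of geometric length. The probability is taken with the insertion/deletion structure (hence $P_H$) fixed; the letters of $S$, substitutions and inserted letters are random. $k$ is the seed length. Homologous path $P_H$: list starting at $(p,0)$; while last element $(i,j)$ has $i+1\le p+m'$, append according to mutations at position $i+1$: no indel: $(i+1,j+1)$; insertion of $I$ letters, no deletion: $(i,j+1),\dots,(i,j+I),(i+1,j+I+1)$; deletion only: $(i+1,j)$; both: $(i,j+1),\dots,(i,j+I),(i+1,j+I)$. $A(i,j)=\prod_{t=0}^{k-1}\mathbf 1\{S[i+t]=S'[j+t]\}$ is the indicator of an anchor at $(i,j)$.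
   Formalization: The substitution probability $\theta_s$ takes only rational values. -}

module Defs where

open import Data.Nat as ℕ using (ℕ; zero; suc; _∸_; _<_)
open import Data.Integer using (+_)
open import Data.Rational using (ℚ; _/_; 0ℚ; 1ℚ)
import Data.Rational as Q
open import Data.Fin using (Fin)
import Data.Fin as F
open import Data.Bool using (Bool; true; false; if_then_else_)
import Data.Bool
open import Data.Maybe using (Maybe; just; nothing)
open import Data.Product using (_×_; _,_)
open import Data.List using (List; []; _∷_; _++_; map; concatMap; filter; length; allFin; upTo)
open import Data.Vec using (Vec)
import Data.Vec as V
open import Relation.Nullary using (does; ¬?)

Dist : Set → Set
Dist A = List (ℚ × A)

return : {A : Set} → A → Dist A
return a = (1ℚ , a) ∷ []

_>>=_ : {A B : Set} → Dist A → (A → Dist B) → Dist B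
d >>= f = concatMap (λ { (w , a) → map (λ { (v , b) → (w Q.* v , b) }) (f a) }) d

-- 1/n as a rational (with the harmless convention inv 0 = 0; only used for n ≥ 1)
inv : ℕ → ℚ
inv zero    = 0ℚ
inv (suc n) = (+ 1) / suc n

uniform : (σ : ℕ) → Dist (Fin σ)
uniform σ = map (λ a → (inv σ , a)) (allFin σ)

uniformString : (σ len : ℕ) → Dist (List (Fin σ))
uniformString σ zero    = return []
uniformString σ (suc l) = uniform σ >>= λ a → uniformString σ l >>= λ w → return (a ∷ w)

Pr : {A : Set} → Dist A → (A → Bool) → ℚ
Pr []            E = 0ℚ
Pr ((w , a) ∷ d) E = (if E a then w else 0ℚ) Q.+ Pr d E

-- Strings, 1-based access:  at w x = w[x]  (nothing if out of range)

at : {A : Set} → List A → ℕ → Maybe A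
at []      _             = nothing
at (a ∷ w) zero          = nothing
at (a ∷ w) (suc zero)    = just a
at (a ∷ w) (suc (suc x)) = at w (suc x)

-- The indel structure: for each position p+t (t = 1..m') a pair
-- (deleted? , I) where I is the (fixed) length of the inserted string.

IndelStructure : ℕ → Set
IndelStructure m' = Vec (Bool × ℕ) m'

substitute : (σ : ℕ) → ℚ → Fin σ → Dist (Fin σ)
substitute σ θs a =
  (1ℚ Q.- θs , a) ∷
  map (λ b → (θs Q.* inv (σ ∸ 1) , b)) (filter (λ b → ¬? (b F.≟ a)) (allFin σ))

-- S' produced from S[p+1 .. p+m'] under the fixed indel structure;
-- position p+t is processed: inserted letters (to its left), then the
-- (possibly substituted) letter unless it is deleted.
emitAt : (σ : ℕ) → ℚ → List (Fin σ) → Maybe (Fin σ) → Dist (List (Fin σ))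
emitAt σ θs ins nothing  = return ins
emitAt σ θs ins (just a) = substitute σ θs a >>= λ b → return (ins ++ (b ∷ []))

channelFrom : (σ : ℕ) → ℚ → List (Fin σ) → ℕ → {m : ℕ} → Vec (Bool × ℕ) m → Dist (List (Fin σ))
channelFrom σ θs S x V.[] = return []
channelFrom σ θs S x ((del , I) V.∷ rest) =
  uniformString σ I >>= λ ins →
  (if del then return ins else emitAt σ θs ins (at S (suc x))) >>= λ here →
  channelFrom σ θs S (suc x) rest >>= λ there →
  return (here ++ there)

-- The full experiment: S uniform of length n, S' = channel(S[p+1..p+m'])
experiment : (σ n p : ℕ) → ℚ → {m' : ℕ} → IndelStructure m' → Dist (List (Fin σ) × List (Fin σ))
experiment σ n p θs str =
  uniformString σ n >>= λ S →
  channelFrom σ θs S p str >>= λ S' →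
  return (S , S')

lengthS' : {m : ℕ} → Vec (Bool × ℕ) m → ℕ
lengthS' V.[] = 0
lengthS' ((del , I) V.∷ rest) = I ℕ.+ (if del then 0 else 1) ℕ.+ lengthS' rest

insSteps : ℕ → ℕ → ℕ → List (ℕ × ℕ)
insSteps i j zero    = []
insSteps i j (suc I) = (i , suc j) ∷ insSteps i (suc j) I

pathFrom : ℕ → ℕ → {m : ℕ} → Vec (Bool × ℕ) m → List (ℕ × ℕ)
pathFrom i j V.[] = []
pathFrom i j ((del , I) V.∷ rest) =
  let j' = if del then j ℕ.+ I else suc (j ℕ.+ I) in
  insSteps i j I ++ ((suc i , j') ∷ pathFrom (suc i) j' rest)

pathH : (p : ℕ) → {m' : ℕ} → IndelStructure m' → List (ℕ × ℕ)
pathH p str = (p , 0) ∷ pathFrom p 0 str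

sameAt : {σ : ℕ} → Maybe (Fin σ) → Maybe (Fin σ) → Bool
sameAt (just a) (just b) = does (a F.≟ b)
sameAt _        _        = false

anchor : {σ : ℕ} → ℕ → List (Fin σ) → List (Fin σ) → ℕ → ℕ → Bool
anchor zero    S S' i j = true
anchor (suc k) S S' i j = sameAt (at S i) (at S' j) Data.Bool.∧ anchor k S S' (suc i) (suc j)

-- Given S, the letters of S' are independent: an inserted letter is uniform, and a letter copied from S[x] is
-- the substitution channel applied to S[x].  So, given S, the anchor probability is a product over t < k of the
-- probabilities that the letter S'[j+t] equals S[i+t]; each factor compares S[i+t] either with a fresh letter or
-- with a copy of some S[x], where x ≠ i+t exactly because (i+t, j+t) is not on P_H.  Both coordinates of these
-- comparisons increase with t, so the first letter of S enters at most one factor.  Averaging that factor over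
-- the first letter gives 1/σ on either side of the comparison: the substitution channel maps the uniform letter
-- to a uniform letter and is symmetric.  Peeling off the letters of S one by one yields (1/σ)^k.

module Submission where

open import Defs
open import Data.Nat as ℕ using (ℕ; zero; suc; pred; _+_; _≤_; _<_; _^_; s≤s; z≤n)
import Data.Nat.Properties as ℕP
open import Data.Nat.Tactic.RingSolver using (solve-∀)
open import Data.Nat.Coprimality using (1-coprimeTo)
import Data.Nat.Coprimality as Coprime
open import Data.Integer as ℤ using (+_)
import Data.Integer.Properties as ℤP
open import Data.Rational using (ℚ; 0ℚ; 1ℚ; mkℚ; 1/_)
import Data.Rational as Q
import Data.Rational.Properties as QP
open import Data.Rational.Solver using (module +-*-Solver)
open import Data.Fin as F using (Fin)
open import Data.Bool using (Bool; true; false; if_then_else_; _∧_)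
open import Data.Maybe using (Maybe; just; nothing)
open import Data.Product using (_×_; _,_; proj₁; proj₂; ∃-syntax)
import Data.Product as Product
open import Data.Unit using (⊤; tt)
open import Data.Vec as V using (Vec)
open import Data.List using (List; []; _∷_; _++_; map; filter; allFin; tabulate; length; replicate; take; drop)
open import Data.List.Properties
  using (length-++; length-replicate; length-take; length-map; map-++; map-replicate; ++-assoc; ++-identityʳ; drop-map)
open import Data.List.Relation.Unary.All as All using (All; []; _∷_)
import Data.List.Relation.Unary.All.Properties as All
open import Data.List.Relation.Unary.Any using (here; there)
open import Data.List.Membership.Propositional using (_∈_; _∉_)
open import Data.List.Membership.Propositional.Properties using (∈-++⁺ʳ)
open import Relation.Nullary using (does; yes; no; ¬?; contradiction)
open import Relation.Unary using (Decidable)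
open import Relation.Binary.PropositionalEquality
open import Function using (_∘_)
open import Algebra.Bundles using (CommutativeRing)
open import Algebra.Properties.Semiring.Sum (CommutativeRing.semiring QP.+-*-commutativeRing)
  using (sum; sum-syntax; ∑-distrib-+; *-distribˡ-sum; sum-cong-≗; sum-replicate-zero)
open import Algebra.Definitions.RawSemiring QP.+-*-rawSemiring using () renaming (_^_ to _^ℚ_)

open +-*-Solver using (solve; _:+_; _:*_; _:-_; _:=_; con)
open ≡-Reasoning

-- Expectations over finite weighted distributions

𝟙 : Bool → ℚ
𝟙 true  = 1ℚ
𝟙 false = 0ℚ

𝟙-∧ : ∀ b c → 𝟙 (b ∧ c) ≡ 𝟙 b Q.* 𝟙 c
𝟙-∧ true  c = sym (QP.*-identityˡ (𝟙 c))
𝟙-∧ false c = sym (QP.*-zeroˡ (𝟙 c))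

𝔼 : {A : Set} → Dist A → (A → ℚ) → ℚ
𝔼 []            f = 0ℚ
𝔼 ((w , a) ∷ d) f = w Q.* f a Q.+ 𝔼 d f

mass : {A : Set} → Dist A → ℚ
mass d = 𝔼 d (λ _ → 1ℚ)

module _ {A : Set} where

  Pr≡𝔼 : (d : Dist A) (E : A → Bool) → Pr d E ≡ 𝔼 d (𝟙 ∘ E)
  Pr≡𝔼 []            E = refl
  Pr≡𝔼 ((w , a) ∷ d) E = cong₂ Q._+_ (weighted (E a)) (Pr≡𝔼 d E)
    where
    weighted : ∀ b → (if b then w else 0ℚ) ≡ w Q.* 𝟙 b
    weighted true  = sym (QP.*-identityʳ w)
    weighted false = sym (QP.*-zeroʳ w)

  𝔼-cong : (d : Dist A) {f g : A → ℚ} → (∀ a → f a ≡ g a) → 𝔼 d f ≡ 𝔼 d g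
  𝔼-cong []            f≗g = refl
  𝔼-cong ((w , a) ∷ d) f≗g = cong₂ (λ x y → w Q.* x Q.+ y) (f≗g a) (𝔼-cong d f≗g)

  𝔼-++ : (d e : Dist A) (f : A → ℚ) → 𝔼 (d ++ e) f ≡ 𝔼 d f Q.+ 𝔼 e f
  𝔼-++ []            e f = sym (QP.+-identityˡ _)
  𝔼-++ ((w , a) ∷ d) e f =
    trans (cong (w Q.* f a Q.+_) (𝔼-++ d e f)) (sym (QP.+-assoc (w Q.* f a) (𝔼 d f) (𝔼 e f)))

  𝔼-*ˡ : (d : Dist A) (c : ℚ) (f : A → ℚ) → 𝔼 d (λ a → c Q.* f a) ≡ c Q.* 𝔼 d f
  𝔼-*ˡ []            c f = sym (QP.*-zeroʳ c)
  𝔼-*ˡ ((w , a) ∷ d) c f = begin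
    w Q.* (c Q.* f a) Q.+ 𝔼 d (λ a → c Q.* f a) ≡⟨ cong (w Q.* (c Q.* f a) Q.+_) (𝔼-*ˡ d c f) ⟩
    w Q.* (c Q.* f a) Q.+ c Q.* 𝔼 d f
      ≡⟨ solve 4 (λ w c x e → w :* (c :* x) :+ c :* e := c :* (w :* x :+ e)) refl w c (f a) (𝔼 d f) ⟩
    c Q.* (w Q.* f a Q.+ 𝔼 d f)                 ∎

  𝔼-*ʳ : (d : Dist A) (c : ℚ) (f : A → ℚ) → 𝔼 d (λ a → f a Q.* c) ≡ 𝔼 d f Q.* c
  𝔼-*ʳ d c f = trans (𝔼-cong d (λ a → QP.*-comm (f a) c)) (trans (𝔼-*ˡ d c f) (QP.*-comm c (𝔼 d f)))

  𝔼-+ : (d : Dist A) (f g : A → ℚ) → 𝔼 d (λ a → f a Q.+ g a) ≡ 𝔼 d f Q.+ 𝔼 d g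
  𝔼-+ []            f g = sym (QP.+-identityˡ 0ℚ)
  𝔼-+ ((w , a) ∷ d) f g = begin
    w Q.* (f a Q.+ g a) Q.+ 𝔼 d (λ a → f a Q.+ g a) ≡⟨ cong (w Q.* (f a Q.+ g a) Q.+_) (𝔼-+ d f g) ⟩
    w Q.* (f a Q.+ g a) Q.+ (𝔼 d f Q.+ 𝔼 d g)
      ≡⟨ solve 5 (λ w x y e e′ → w :* (x :+ y) :+ (e :+ e′) := (w :* x :+ e) :+ (w :* y :+ e′))
               refl w (f a) (g a) (𝔼 d f) (𝔼 d g) ⟩
    (w Q.* f a Q.+ 𝔼 d f) Q.+ (w Q.* g a Q.+ 𝔼 d g) ∎

  𝔼-const : (d : Dist A) (c : ℚ) → 𝔼 d (λ _ → c) ≡ c Q.* mass d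
  𝔼-const d c = trans (𝔼-cong d (λ _ → sym (QP.*-identityʳ c))) (𝔼-*ˡ d c (λ _ → 1ℚ))

  𝔼-const-normalised : (d : Dist A) {c : ℚ} → mass d ≡ 1ℚ → 𝔼 d (λ _ → c) ≡ c
  𝔼-const-normalised d {c} mass≡1 = trans (𝔼-const d c) (trans (cong (c Q.*_) mass≡1) (QP.*-identityʳ c))

  𝔼-return : (a : A) (f : A → ℚ) → 𝔼 (return a) f ≡ f a
  𝔼-return a f = trans (QP.+-identityʳ _) (QP.*-identityˡ _)

  -- Stated for any h acting as the rescaling, since the one inside _>>=_ is a pattern lambda of Defs.
  𝔼-rescale : (w : ℚ) (h : ℚ × A → ℚ × A) → (∀ v a → h (v , a) ≡ (w Q.* v , a)) →
    (d : Dist A) (f : A → ℚ) → 𝔼 (map h d) f ≡ w Q.* 𝔼 d f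
  𝔼-rescale w h h-scales []            f = sym (QP.*-zeroʳ w)
  𝔼-rescale w h h-scales ((v , a) ∷ d) f rewrite h-scales v a = begin
    w Q.* v Q.* f a Q.+ 𝔼 (map h d) f ≡⟨ cong (w Q.* v Q.* f a Q.+_) (𝔼-rescale w h h-scales d f) ⟩
    w Q.* v Q.* f a Q.+ w Q.* 𝔼 d f
      ≡⟨ solve 4 (λ w v x e → w :* v :* x :+ w :* e := w :* (v :* x :+ e)) refl w v (f a) (𝔼 d f) ⟩
    w Q.* (v Q.* f a Q.+ 𝔼 d f)       ∎

𝔼->>= : {A B : Set} (d : Dist A) (g : A → Dist B) (f : B → ℚ) → 𝔼 (d >>= g) f ≡ 𝔼 d (λ a → 𝔼 (g a) f)
𝔼->>= []            g f = refl
𝔼->>= ((w , a) ∷ d) g f =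
  trans (𝔼-++ (map _ (g a)) (d >>= g) f)
        (cong₂ Q._+_ (𝔼-rescale w _ (λ _ _ → refl) (g a) f) (𝔼->>= d g f))

𝔼-sequence : {A B C : Set} (d : Dist A) (e : A → Dist B) (g : A → B → C) (f : C → ℚ) →
  𝔼 (d >>= λ a → e a >>= λ b → return (g a b)) f ≡ 𝔼 d (λ a → 𝔼 (e a) (λ b → f (g a b)))
𝔼-sequence d e g f =
  trans (𝔼->>= d (λ a → e a >>= λ b → return (g a b)) f) (𝔼-cong d λ a →
    trans (𝔼->>= (e a) (λ b → return (g a b)) f) (𝔼-cong (e a) λ b → 𝔼-return (g a b) f))

𝔼-swap : {A B : Set} (d : Dist A) (e : Dist B) (h : A → B → ℚ) →
  𝔼 d (λ a → 𝔼 e (h a)) ≡ 𝔼 e (λ b → 𝔼 d (λ a → h a b))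
𝔼-swap []            e h = sym (trans (𝔼-const e 0ℚ) (QP.*-zeroˡ (mass e)))
𝔼-swap ((w , a) ∷ d) e h = begin
  w Q.* 𝔼 e (h a) Q.+ 𝔼 d (λ a → 𝔼 e (h a))
    ≡⟨ cong₂ Q._+_ (sym (𝔼-*ˡ e w (h a))) (𝔼-swap d e h) ⟩
  𝔼 e (λ b → w Q.* h a b) Q.+ 𝔼 e (λ b → 𝔼 d (λ a → h a b))
    ≡⟨ sym (𝔼-+ e _ _) ⟩
  𝔼 e (λ b → w Q.* h a b Q.+ 𝔼 d (λ a → h a b))
    ∎

-- The uniform letter and the substitution channel

δ : ∀ {n} → Fin n → Fin n → ℚ
δ a b = 𝟙 (does (a F.≟ b))

δ-sym : ∀ {n} (a b : Fin n) → δ a b ≡ δ b a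
δ-sym a b with a F.≟ b | b F.≟ a
... | yes _   | yes _   = refl
... | no  _   | no  _   = refl
... | yes a≡b | no  b≢a = contradiction (sym a≡b) b≢a
... | no  a≢b | yes b≡a = contradiction (sym b≡a) a≢b

∑-δ : ∀ {n} (c : Fin n) → ∑[ b < n ] δ c b ≡ 1ℚ
∑-δ {suc n} F.zero    = trans (cong (1ℚ Q.+_) (sum-replicate-zero n)) (QP.+-identityʳ 1ℚ)
∑-δ {suc n} (F.suc c) = trans (QP.+-identityˡ _) (∑-δ c)

∑-remove : ∀ {n} (f : Fin n → ℚ) (a : Fin n) →
  ∑[ b < n ] f b ≡ ∑[ b < n ] (if does (¬? (b F.≟ a)) then f b else 0ℚ) Q.+ f a
∑-remove {n} f a = begin
  ∑[ b < n ] f b                                ≡⟨ sum-cong-≗ split ⟩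
  ∑[ b < n ] (others b Q.+ f a Q.* δ b a)       ≡⟨ ∑-distrib-+ others _ ⟩
  sum others Q.+ ∑[ b < n ] (f a Q.* δ b a)     ≡⟨ cong (sum others Q.+_) (sym (*-distribˡ-sum (f a) (λ b → δ b a))) ⟩
  sum others Q.+ f a Q.* ∑[ b < n ] δ b a
    ≡⟨ cong (λ s → sum others Q.+ f a Q.* s) (trans (sum-cong-≗ (λ b → δ-sym b a)) (∑-δ a)) ⟩
  sum others Q.+ f a Q.* 1ℚ                     ≡⟨ cong (sum others Q.+_) (QP.*-identityʳ (f a)) ⟩
  sum others Q.+ f a                            ∎
  where
  others : Fin n → ℚ
  others b = if does (¬? (b F.≟ a)) then f b else 0ℚ
  split : ∀ b → f b ≡ others b Q.+ f a Q.* δ b a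
  split b with b F.≟ a
  ... | yes refl = solve 1 (λ x → x := con 0ℚ :+ x :* con 1ℚ) refl (f b)
  ... | no  _    = solve 2 (λ x y → x := x :+ y :* con 0ℚ) refl (f b) (f a)

𝔼-weighted-allFin : (w : ℚ) (n : ℕ) (f : Fin n → ℚ) →
  𝔼 (map (λ b → (w , b)) (allFin n)) f ≡ w Q.* ∑[ b < n ] f b
𝔼-weighted-allFin w n f = 𝔼-tabulate n (λ b → b)
  where
  𝔼-tabulate : ∀ k (h : Fin k → Fin n) → 𝔼 (map (λ b → (w , b)) (tabulate h)) f ≡ w Q.* ∑[ b < k ] f (h b)
  𝔼-tabulate zero    h = sym (QP.*-zeroʳ w)
  𝔼-tabulate (suc k) h =
    trans (cong (w Q.* f (h F.zero) Q.+_) (𝔼-tabulate k (h ∘ F.suc))) (sym (QP.*-distribˡ-+ w _ _))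

𝔼-filter : {B : Set} {P : B → Set} (w : ℚ) (P? : Decidable P) (l : List B) (f : B → ℚ) →
  𝔼 (map (λ b → (w , b)) (filter P? l)) f ≡ 𝔼 (map (λ b → (w , b)) l) (λ b → if does (P? b) then f b else 0ℚ)
𝔼-filter w P? []      f = refl
𝔼-filter w P? (b ∷ l) f with does (P? b)
... | true  = cong (w Q.* f b Q.+_) (𝔼-filter w P? l f)
... | false = trans (𝔼-filter w P? l f) (sym (trans (cong (Q._+ rest) (QP.*-zeroʳ w)) (QP.+-identityˡ rest)))
  where rest = 𝔼 (map (λ b → (w , b)) l) (λ b → if does (P? b) then f b else 0ℚ)

inv-suc : ∀ n → inv (suc n) ≡ mkℚ (+ 1) n (1-coprimeTo (suc n))
inv-suc n = QP.↥p/↧p≡p (mkℚ (+ 1) n (1-coprimeTo (suc n)))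

inv-* : ∀ a b → inv (a ℕ.* b) ≡ inv a Q.* inv b
inv-* zero    b       = sym (QP.*-zeroˡ (inv b))
inv-* (suc a) zero    rewrite ℕP.*-zeroʳ a = sym (QP.*-zeroʳ (inv (suc a)))
inv-* (suc a) (suc b) rewrite inv-suc a | inv-suc b = refl

inv-^ : ∀ σ k → inv (σ ^ k) ≡ inv σ ^ℚ k
inv-^ σ zero    = refl
inv-^ σ (suc k) = trans (inv-* σ (σ ^ k)) (cong (inv σ Q.*_) (inv-^ σ k))

inv-*-∑1 : ∀ n → inv (suc n) Q.* ∑[ _ < suc n ] 1ℚ ≡ 1ℚ
inv-*-∑1 n = begin
  inv (suc n) Q.* ∑[ _ < suc n ] 1ℚ     ≡⟨ cong₂ Q._*_ (inv-suc n) (∑1≡fromℕ (suc n)) ⟩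
  1/ fromℕ (suc n) Q.* fromℕ (suc n)   ≡⟨ QP.*-inverseˡ (fromℕ (suc n)) ⟩
  1ℚ                                   ∎
  where
  fromℕ : ℕ → ℚ
  fromℕ k = mkℚ (+ k) 0 (Coprime.sym (1-coprimeTo k))
  ∑1≡fromℕ : ∀ k → ∑[ _ < k ] 1ℚ ≡ fromℕ k
  ∑1≡fromℕ zero    = refl
  ∑1≡fromℕ (suc k) =
    trans (cong (1ℚ Q.+_) (∑1≡fromℕ k))
          (trans (QP./-cong {p₂ = + suc k} {q₂ = 1} numerator refl) (QP.↥p/↧p≡p (fromℕ (suc k))))
    where
    numerator : + 1 ℤ.* + 1 ℤ.+ + k ℤ.* + 1 ≡ + suc k
    numerator = cong (λ z → + 1 ℤ.+ z) (ℤP.*-identityʳ (+ k))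

𝔼-uniform : (σ : ℕ) (f : Fin σ → ℚ) → 𝔼 (uniform σ) f ≡ inv σ Q.* ∑[ a < σ ] f a
𝔼-uniform σ = 𝔼-weighted-allFin (inv σ) σ

mass-uniform : ∀ n → mass (uniform (suc n)) ≡ 1ℚ
mass-uniform n = trans (𝔼-uniform (suc n) _) (inv-*-∑1 n)

-- The junk value at nothing makes a comparison with a position outside S weigh like one with a fresh letter.
hit : {σ : ℕ} → Dist (Fin σ) → Maybe (Fin σ) → ℚ
hit     d (just c) = 𝔼 d (δ c)
hit {σ} d nothing  = inv σ

hit-uniform : ∀ {σ} (mc : Maybe (Fin σ)) → hit (uniform σ) mc ≡ inv σ
hit-uniform {σ} (just c) = trans (𝔼-uniform σ _) (trans (cong (inv σ Q.*_) (∑-δ c)) (QP.*-identityʳ (inv σ)))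
hit-uniform     nothing  = refl

𝔼-uniform-hit : ∀ {n} (d : Dist (Fin (suc n))) → mass d ≡ 1ℚ →
  𝔼 (uniform (suc n)) (λ c → hit d (just c)) ≡ inv (suc n)
𝔼-uniform-hit {n} d mass≡1 = begin
  𝔼 (uniform (suc n)) (λ c → 𝔼 d (δ c))  ≡⟨ 𝔼-swap (uniform (suc n)) d δ ⟩
  𝔼 d (λ b → 𝔼 (uniform (suc n)) (λ c → δ c b))
    ≡⟨ 𝔼-cong d (λ b → trans (𝔼-cong (uniform (suc n)) (λ c → δ-sym c b)) (hit-uniform (just b))) ⟩
  𝔼 d (λ _ → inv (suc n))               ≡⟨ 𝔼-const-normalised d mass≡1 ⟩
  inv (suc n)                           ∎

module _ (m : ℕ) (θs : ℚ) where

  private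
    σ : ℕ
    σ = suc (suc m)

    τ : ℚ
    τ = θs Q.* inv (suc m)

  𝔼-substitute : (a : Fin σ) (f : Fin σ → ℚ) →
    𝔼 (substitute σ θs a) f ≡ (1ℚ Q.- θs) Q.* f a Q.+ τ Q.* (∑[ b < σ ] f b Q.- f a)
  𝔼-substitute a f = cong ((1ℚ Q.- θs) Q.* f a Q.+_) (begin
    𝔼 (map (λ b → (τ , b)) (filter (λ b → ¬? (b F.≟ a)) (allFin σ))) f
      ≡⟨ 𝔼-filter τ (λ b → ¬? (b F.≟ a)) (allFin σ) f ⟩
    𝔼 (map (λ b → (τ , b)) (allFin σ)) others
      ≡⟨ 𝔼-weighted-allFin τ σ others ⟩
    τ Q.* sum others
      ≡⟨ cong (τ Q.*_) (solve 2 (λ s x → s := (s :+ x) :- x) refl (sum others) (f a)) ⟩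
    τ Q.* (sum others Q.+ f a Q.- f a)
      ≡⟨ cong (λ s → τ Q.* (s Q.- f a)) (sym (∑-remove f a)) ⟩
    τ Q.* (∑[ b < σ ] f b Q.- f a)
      ∎)
    where
    others : Fin σ → ℚ
    others b = if does (¬? (b F.≟ a)) then f b else 0ℚ

  mass-substitute : (a : Fin σ) → mass (substitute σ θs a) ≡ 1ℚ
  mass-substitute a = begin
    mass (substitute σ θs a)
      ≡⟨ 𝔼-substitute a (λ _ → 1ℚ) ⟩
    (1ℚ Q.- θs) Q.* 1ℚ Q.+ θs Q.* inv (suc m) Q.* (1ℚ Q.+ s Q.- 1ℚ)
      ≡⟨ solve 3 (λ t i s → (con 1ℚ :- t) :* con 1ℚ :+ t :* i :* (con 1ℚ :+ s :- con 1ℚ)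
                            := con 1ℚ :- t :+ t :* (i :* s)) refl θs (inv (suc m)) s ⟩
    1ℚ Q.- θs Q.+ θs Q.* (inv (suc m) Q.* s)
      ≡⟨ cong (λ x → 1ℚ Q.- θs Q.+ θs Q.* x) (inv-*-∑1 m) ⟩
    1ℚ Q.- θs Q.+ θs Q.* 1ℚ
      ≡⟨ solve 1 (λ t → con 1ℚ :- t :+ t :* con 1ℚ := con 1ℚ) refl θs ⟩
    1ℚ
      ∎
    where
    s = ∑[ _ < suc m ] 1ℚ

  hit-substitute : (a c : Fin σ) → hit (substitute σ θs a) (just c) ≡ (1ℚ Q.- θs) Q.* δ c a Q.+ τ Q.* (1ℚ Q.- δ c a)
  hit-substitute a c =
    trans (𝔼-substitute a (δ c)) (cong (λ s → (1ℚ Q.- θs) Q.* δ c a Q.+ τ Q.* (s Q.- δ c a)) (∑-δ c))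

  hit-substitute-sym : (a c : Fin σ) → hit (substitute σ θs a) (just c) ≡ hit (substitute σ θs c) (just a)
  hit-substitute-sym a c = begin
    hit (substitute σ θs a) (just c)                            ≡⟨ hit-substitute a c ⟩
    (1ℚ Q.- θs) Q.* δ c a Q.+ τ Q.* (1ℚ Q.- δ c a)
      ≡⟨ cong (λ x → (1ℚ Q.- θs) Q.* x Q.+ τ Q.* (1ℚ Q.- x)) (δ-sym c a) ⟩
    (1ℚ Q.- θs) Q.* δ a c Q.+ τ Q.* (1ℚ Q.- δ a c)              ≡⟨ sym (hit-substitute c a) ⟩
    hit (substitute σ θs c) (just a)                            ∎

  𝔼-uniform-hit-substitute : (mc : Maybe (Fin σ)) → 𝔼 (uniform σ) (λ a → hit (substitute σ θs a) mc) ≡ inv σ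
  𝔼-uniform-hit-substitute (just c) =
    trans (𝔼-cong (uniform σ) (λ a → hit-substitute-sym a c)) (𝔼-uniform-hit (substitute σ θs c) (mass-substitute c))
  𝔼-uniform-hit-substitute nothing = 𝔼-const-normalised (uniform σ) (mass-uniform (suc m))

-- Independent letters

independent : {A : Set} → List (Dist A) → Dist (List A)
independent []       = return []
independent (d ∷ ds) = d >>= λ a → independent ds >>= λ w → return (a ∷ w)

uniformString≡independent : ∀ σ n → uniformString σ n ≡ independent (replicate n (uniform σ))
uniformString≡independent σ zero    = refl
uniformString≡independent σ (suc n) =
  cong (λ e → uniform σ >>= λ a → e >>= λ w → return (a ∷ w)) (uniformString≡independent σ n)

module _ {A : Set} where

  𝔼-independent-∷ : (d : Dist A) (ds : List (Dist A)) (f : List A → ℚ) →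
    𝔼 (independent (d ∷ ds)) f ≡ 𝔼 d (λ a → 𝔼 (independent ds) (λ w → f (a ∷ w)))
  𝔼-independent-∷ d ds = 𝔼-sequence d (λ _ → independent ds) _∷_

  𝔼-independent-++ : (ds es : List (Dist A)) (f : List A → ℚ) →
    𝔼 (independent (ds ++ es)) f ≡ 𝔼 (independent ds) (λ v → 𝔼 (independent es) (λ w → f (v ++ w)))
  𝔼-independent-++ []       es f = sym (𝔼-return {List A} [] (λ v → 𝔼 (independent es) (λ w → f (v ++ w))))
  𝔼-independent-++ (d ∷ ds) es f = begin
    𝔼 (independent (d ∷ ds ++ es)) f
      ≡⟨ 𝔼-independent-∷ d (ds ++ es) f ⟩
    𝔼 d (λ a → 𝔼 (independent (ds ++ es)) (λ w → f (a ∷ w)))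
      ≡⟨ 𝔼-cong d (λ a → 𝔼-independent-++ ds es (λ w → f (a ∷ w))) ⟩
    𝔼 d (λ a → 𝔼 (independent ds) (λ v → 𝔼 (independent es) (λ w → f (a ∷ v ++ w))))
      ≡⟨ sym (𝔼-independent-∷ d ds _) ⟩
    𝔼 (independent (d ∷ ds)) (λ v → 𝔼 (independent es) (λ w → f (v ++ w)))
      ∎

  mass-independent : (ds : List (Dist A)) → All (λ d → mass d ≡ 1ℚ) ds → mass (independent ds) ≡ 1ℚ
  mass-independent []       []                  = 𝔼-return {List A} [] (λ _ → 1ℚ)
  mass-independent (d ∷ ds) (mass≡1 ∷ masses≡1) =
    trans (𝔼-independent-∷ d ds _) (trans (𝔼-cong d (λ _ → mass-independent ds masses≡1)) mass≡1)

module _ {σ : ℕ} where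

  𝔼-uniformString-suc : ∀ n (f : List (Fin σ) → ℚ) →
    𝔼 (uniformString σ (suc n)) f ≡ 𝔼 (uniform σ) (λ a → 𝔼 (uniformString σ n) (λ w → f (a ∷ w)))
  𝔼-uniformString-suc n = 𝔼-sequence (uniform σ) (λ _ → uniformString σ n) _∷_

  𝔼-uniformString-cong : ∀ n {f g : List (Fin σ) → ℚ} → (∀ S → length S ≡ n → f S ≡ g S) →
    𝔼 (uniformString σ n) f ≡ 𝔼 (uniformString σ n) g
  𝔼-uniformString-cong zero    {f} {g} f≗g =
    trans (𝔼-return {List (Fin σ)} [] f) (trans (f≗g [] refl) (sym (𝔼-return {List (Fin σ)} [] g)))
  𝔼-uniformString-cong (suc n) {f} {g} f≗g = begin
    𝔼 (uniformString σ (suc n)) f                                   ≡⟨ 𝔼-uniformString-suc n f ⟩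
    𝔼 (uniform σ) (λ a → 𝔼 (uniformString σ n) (λ w → f (a ∷ w)))
      ≡⟨ 𝔼-cong (uniform σ) (λ a → 𝔼-uniformString-cong n (λ w ∣w∣≡n → f≗g (a ∷ w) (cong suc ∣w∣≡n))) ⟩
    𝔼 (uniform σ) (λ a → 𝔼 (uniformString σ n) (λ w → g (a ∷ w)))  ≡⟨ sym (𝔼-uniformString-suc n g) ⟩
    𝔼 (uniformString σ (suc n)) g                                   ∎

  𝔼-uniformString-peel : ∀ n {f : List (Fin σ) → ℚ} (g : Fin σ → List (Fin σ) → ℚ) (h : List (Fin σ) → ℚ) →
    (∀ a w → f (a ∷ w) ≡ g a w Q.* h w) → (∀ w → 𝔼 (uniform σ) (λ a → g a w) ≡ inv σ) →
    𝔼 (uniformString σ (suc n)) f ≡ inv σ Q.* 𝔼 (uniformString σ n) h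
  𝔼-uniformString-peel n {f} g h f-splits g-averages = begin
    𝔼 (uniformString σ (suc n)) f
      ≡⟨ 𝔼-uniformString-suc n f ⟩
    𝔼 (uniform σ) (λ a → 𝔼 (uniformString σ n) (λ w → f (a ∷ w)))
      ≡⟨ 𝔼-cong (uniform σ) (λ a → 𝔼-cong (uniformString σ n) (f-splits a)) ⟩
    𝔼 (uniform σ) (λ a → 𝔼 (uniformString σ n) (λ w → g a w Q.* h w))
      ≡⟨ 𝔼-swap (uniform σ) (uniformString σ n) _ ⟩
    𝔼 (uniformString σ n) (λ w → 𝔼 (uniform σ) (λ a → g a w Q.* h w))
      ≡⟨ 𝔼-cong (uniformString σ n) (λ w → 𝔼-*ʳ (uniform σ) (h w) (λ a → g a w)) ⟩
    𝔼 (uniformString σ n) (λ w → 𝔼 (uniform σ) (λ a → g a w) Q.* h w)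
      ≡⟨ 𝔼-cong (uniformString σ n) (λ w → cong (Q._* h w) (g-averages w)) ⟩
    𝔼 (uniformString σ n) (λ w → inv σ Q.* h w)
      ≡⟨ 𝔼-*ˡ (uniformString σ n) (inv σ) h ⟩
    inv σ Q.* 𝔼 (uniformString σ n) h
      ∎

module _ {m : ℕ} where

  mass-uniformString : ∀ n → mass (uniformString (suc m) n) ≡ 1ℚ
  mass-uniformString zero    = 𝔼-return {List (Fin (suc m))} [] (λ _ → 1ℚ)
  mass-uniformString (suc n) =
    trans (𝔼-uniformString-suc {suc m} n (λ _ → 1ℚ))
          (trans (𝔼-cong (uniform (suc m)) (λ _ → mass-uniformString n))
                 (𝔼-const-normalised (uniform (suc m)) (mass-uniform m)))

  𝔼-uniformString-tail : ∀ n {f : List (Fin (suc m)) → ℚ} (h : List (Fin (suc m)) → ℚ) →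
    (∀ a w → f (a ∷ w) ≡ h w) → 𝔼 (uniformString (suc m) (suc n)) f ≡ 𝔼 (uniformString (suc m) n) h
  𝔼-uniformString-tail n {f} h f≗h =
    trans (𝔼-uniformString-suc n f)
          (trans (𝔼-cong (uniform (suc m)) (λ a → 𝔼-cong (uniformString (suc m) n) (f≗h a)))
                 (𝔼-const-normalised (uniform (suc m)) (mass-uniform m)))

-- Where the letters of S' come from

module _ {A : Set} where

  at-just : (l : List A) (y : ℕ) → 1 ≤ y → y ≤ length l → ∃[ a ] at l y ≡ just a
  at-just (a ∷ l) (suc zero)    _ _        = a , refl
  at-just (a ∷ l) (suc (suc y)) _ (s≤s y≤) = at-just l (suc y) (s≤s z≤n) y≤

  at-drop : ∀ n (l : List A) y → at (drop n l) (suc y) ≡ at l (suc (n + y))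
  at-drop zero    l       y = refl
  at-drop (suc n) []      y = refl
  at-drop (suc n) (a ∷ l) y = at-drop n l y

  at-take : ∀ k (l : List A) y {a} → at (take k l) (suc y) ≡ just a → y < k × at l (suc y) ≡ just a
  at-take (suc k) (b ∷ l) zero    eq = s≤s z≤n , eq
  at-take (suc k) (b ∷ l) (suc y) eq with at-take k l y eq
  ... | y<k , eq′ = s≤s y<k , eq′

  ≤-length-drop : ∀ j k (l : List A) → j + k ≤ length l → k ≤ length (drop j l)
  ≤-length-drop zero    k l       k≤         = k≤
  ≤-length-drop (suc j) k (a ∷ l) (s≤s j+k≤) = ≤-length-drop j k l j+k≤

-- copyOf x: the letter is S[x] passed through the substitution channel (positions of S count from 1).
data Origin : Set where
  inserted : Origin
  copyOf   : ℕ → Origin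

kept : Bool → ℕ → List Origin
kept true  x = []
kept false x = copyOf (suc x) ∷ []

origins : ℕ → {m : ℕ} → Vec (Bool × ℕ) m → List Origin
origins x V.[]                 = []
origins x ((del , I) V.∷ rest) = replicate I inserted ++ (kept del x ++ origins (suc x) rest)

length-origins : ∀ x {m} (str : Vec (Bool × ℕ) m) → length (origins x str) ≡ lengthS' str
length-origins x V.[]                 = refl
length-origins x ((del , I) V.∷ rest) = begin
  length (replicate I inserted ++ (kept del x ++ origins (suc x) rest))
    ≡⟨ length-++ (replicate I inserted) ⟩
  length (replicate I inserted) + length (kept del x ++ origins (suc x) rest)
    ≡⟨ cong₂ _+_ (length-replicate I) (length-kept del) ⟩
  I + ((if del then 0 else 1) + lengthS' rest)
    ≡⟨ sym (ℕP.+-assoc I _ (lengthS' rest)) ⟩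
  lengthS' ((del , I) V.∷ rest)
    ∎
  where
  length-kept : ∀ del → length (kept del x ++ origins (suc x) rest) ≡ (if del then 0 else 1) + lengthS' rest
  length-kept true  = length-origins (suc x) rest
  length-kept false = cong suc (length-origins (suc x) rest)

at-inserted-++ : ∀ I (R : List Origin) y {a} → at (replicate I inserted ++ R) y ≡ just (copyOf a) →
  ∃[ y′ ] y ≡ I + y′ × at R y′ ≡ just (copyOf a)
at-inserted-++ zero    R y             eq = y , refl , eq
at-inserted-++ (suc I) R (suc (suc y)) eq with at-inserted-++ I R (suc y) eq
... | y′ , y≡I+y′ , eq′ = y′ , cong suc y≡I+y′ , eq′

copy-on-path : ∀ x j {m} (str : Vec (Bool × ℕ) m) y {a} →
  at (origins x str) y ≡ just (copyOf a) → (a , j + y) ∈ pathFrom x j str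
copy-on-path x j ((true , I) V.∷ rest) y {a} eq with at-inserted-++ I _ y eq
... | y′ , refl , eq′ =
  ∈-++⁺ʳ (insSteps x j I) (there (subst (λ z → (a , z) ∈ pathFrom (suc x) (j + I) rest) (ℕP.+-assoc j I y′)
    (copy-on-path (suc x) (j + I) rest y′ eq′)))
copy-on-path x j ((false , I) V.∷ rest) y {a} eq with at-inserted-++ I _ y eq
... | suc zero , refl , refl =
  ∈-++⁺ʳ (insSteps x j I) (here (cong (suc x ,_) (arith j I)))
  where
  arith : ∀ j I → j + (I + 1) ≡ suc (j + I)
  arith = solve-∀
... | suc (suc y′) , refl , eq′ =
  ∈-++⁺ʳ (insSteps x j I) (there (subst (λ z → (a , z) ∈ pathFrom (suc x) (suc (j + I)) rest) (arith j I y′)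
    (copy-on-path (suc x) (suc (j + I)) rest (suc y′) eq′)))
  where
  arith : ∀ j I y → suc (j + I) + suc y ≡ j + (I + suc (suc y))
  arith = solve-∀

CopiesFrom : ℕ → List Origin → Set
CopiesFrom lb []              = ⊤
CopiesFrom lb (inserted ∷ os) = CopiesFrom lb os
CopiesFrom lb (copyOf x ∷ os) = lb ≤ x × CopiesFrom (suc x) os

copiesFrom-weaken : ∀ {lb lb′} os → lb′ ≤ lb → CopiesFrom lb os → CopiesFrom lb′ os
copiesFrom-weaken []              _    _                = tt
copiesFrom-weaken (inserted ∷ os) lb′≤ copies           = copiesFrom-weaken os lb′≤ copies
copiesFrom-weaken (copyOf x ∷ os) lb′≤ (lb≤ , copies) = ℕP.≤-trans lb′≤ lb≤ , copies

copiesFrom-drop : ∀ {lb} n os → CopiesFrom lb os → CopiesFrom lb (drop n os)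
copiesFrom-drop zero    os              copies         = copies
copiesFrom-drop (suc n) []              copies         = tt
copiesFrom-drop (suc n) (inserted ∷ os) copies         = copiesFrom-drop n os copies
copiesFrom-drop (suc n) (copyOf x ∷ os) (lb≤ , copies) =
  copiesFrom-drop n os (copiesFrom-weaken os (ℕP.≤-trans lb≤ (ℕP.n≤1+n x)) copies)

copiesFrom-take : ∀ {lb} k os → CopiesFrom lb os → CopiesFrom lb (take k os)
copiesFrom-take zero    os              copies         = tt
copiesFrom-take (suc k) []              copies         = tt
copiesFrom-take (suc k) (inserted ∷ os) copies         = copiesFrom-take k os copies
copiesFrom-take (suc k) (copyOf x ∷ os) (lb≤ , copies) = lb≤ , copiesFrom-take k os copies

copiesFrom-inserted-++ : ∀ {lb os} I → CopiesFrom lb os → CopiesFrom lb (replicate I inserted ++ os)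
copiesFrom-inserted-++ zero    copies = copies
copiesFrom-inserted-++ (suc I) copies = copiesFrom-inserted-++ I copies

copiesFrom-origins : ∀ x {m} (str : Vec (Bool × ℕ) m) → CopiesFrom (suc x) (origins x str)
copiesFrom-origins x V.[]                   = tt
copiesFrom-origins x ((true , I) V.∷ rest)  =
  copiesFrom-inserted-++ I (copiesFrom-weaken (origins (suc x) rest) (ℕP.n≤1+n (suc x)) (copiesFrom-origins (suc x) rest))
copiesFrom-origins x ((false , I) V.∷ rest) = copiesFrom-inserted-++ I (ℕP.≤-refl , copiesFrom-origins (suc x) rest)

-- The comparisons made by an anchor

comparisons : ℕ → List Origin → List (ℕ × Origin)
comparisons u []       = []
comparisons u (o ∷ os) = (u , o) ∷ comparisons (suc u) os

length-comparisons : ∀ u os → length (comparisons u os) ≡ length os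
length-comparisons u []       = refl
length-comparisons u (o ∷ os) = cong suc (length-comparisons (suc u) os)

OffDiagonalChain : ℕ → ℕ → List (ℕ × Origin) → Set
OffDiagonalChain lu lx []                    = ⊤
OffDiagonalChain lu lx ((u , inserted) ∷ cs) = lu ≤ u × OffDiagonalChain (suc u) lx cs
OffDiagonalChain lu lx ((u , copyOf x) ∷ cs) = lu ≤ u × lx ≤ x × u ≢ x × OffDiagonalChain (suc u) (suc x) cs

chain-weaken : ∀ {lu lx lu′ lx′} cs → lu′ ≤ lu → lx′ ≤ lx → OffDiagonalChain lu lx cs → OffDiagonalChain lu′ lx′ cs
chain-weaken []                    _    _    _                         = tt
chain-weaken ((u , inserted) ∷ cs) lu′≤ lx′≤ (lu≤ , chain)             =
  ℕP.≤-trans lu′≤ lu≤ , chain-weaken cs ℕP.≤-refl lx′≤ chain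
chain-weaken ((u , copyOf x) ∷ cs) lu′≤ lx′≤ (lu≤ , lx≤ , u≢x , chain) =
  ℕP.≤-trans lu′≤ lu≤ , ℕP.≤-trans lx′≤ lx≤ , u≢x , chain

chain-comparisons : ∀ {lx} u os → CopiesFrom lx os →
  (∀ t {a} → at os (suc t) ≡ just (copyOf a) → a ≢ u + t) → OffDiagonalChain u lx (comparisons u os)
chain-comparisons u []              _              _        = tt
chain-comparisons u (inserted ∷ os) copies         off-diag =
  ℕP.≤-refl , chain-comparisons (suc u) os copies (λ t eq a≡ → off-diag (suc t) eq (trans a≡ (sym (ℕP.+-suc u t))))
chain-comparisons u (copyOf x ∷ os) (lx≤ , copies) off-diag =
  ℕP.≤-refl , lx≤ , (λ u≡x → off-diag 0 refl (trans (sym u≡x) (sym (ℕP.+-identityʳ u)))) ,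
  chain-comparisons (suc u) os copies (λ t eq a≡ → off-diag (suc t) eq (trans a≡ (sym (ℕP.+-suc u t))))

anchorComparisons : ℕ → {m′ : ℕ} → IndelStructure m′ → ℕ → ℕ → ℕ → List (ℕ × Origin)
anchorComparisons p str i j k = comparisons i (take k (drop j (origins p str)))

length-anchorComparisons : ∀ p {m′} (str : IndelStructure m′) i j k → j + k ≤ lengthS' str →
  length (anchorComparisons p str i j k) ≡ k
length-anchorComparisons p str i j k j+k≤ = begin
  length (anchorComparisons p str i j k)  ≡⟨ length-comparisons i (take k (drop j os)) ⟩
  length (take k (drop j os))             ≡⟨ length-take k (drop j os) ⟩
  k ℕ.⊓ length (drop j os)
    ≡⟨ ℕP.m≤n⇒m⊓n≡m (≤-length-drop j k os (subst (j + k ≤_) (sym (length-origins p str)) j+k≤)) ⟩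
  k                                       ∎
  where os = origins p str

chain-anchorComparisons : ∀ p {m′} (str : IndelStructure m′) i j k → 1 ≤ i →
  (∀ l → l < k → (i + l , suc j + l) ∉ pathH p str) → OffDiagonalChain 1 1 (anchorComparisons p str i j k)
chain-anchorComparisons p str i j k 1≤i off-path =
  chain-weaken (anchorComparisons p str i j k) 1≤i ℕP.≤-refl (chain-comparisons i window copies off-diagonal)
  where
  os = origins p str
  window = take k (drop j os)
  copies : CopiesFrom 1 window
  copies = copiesFrom-take k _ (copiesFrom-drop j os (copiesFrom-weaken os (s≤s z≤n) (copiesFrom-origins p str)))
  off-diagonal : ∀ t {a} → at window (suc t) ≡ just (copyOf a) → a ≢ i + t
  off-diagonal t eq a≡i+t with at-take k (drop j os) t eq
  ... | t<k , eq′ = off-path t t<k (there (subst (λ z → (z , suc j + t) ∈ pathFrom p 0 str) a≡i+t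
          (copy-on-path p 0 str (suc (j + t)) (trans (sym (at-drop j os t)) eq′))))

anchor-∷ : ∀ {σ} k (S : List (Fin σ)) b w i j → anchor k S (b ∷ w) i (suc (suc j)) ≡ anchor k S w i (suc j)
anchor-∷ zero    S b w i j = refl
anchor-∷ (suc k) S b w i j = cong (sameAt (at S i) (at w (suc j)) ∧_) (anchor-∷ k S b w (suc i) (suc j))

𝔼-anchor-drop : ∀ {σ} k (S : List (Fin σ)) i j (ds : List (Dist (Fin σ))) →
  All (λ d → mass d ≡ 1ℚ) ds → j ≤ length ds →
  𝔼 (independent ds) (λ S′ → 𝟙 (anchor k S S′ i (suc j)))
    ≡ 𝔼 (independent (drop j ds)) (λ S′ → 𝟙 (anchor k S S′ i 1))
𝔼-anchor-drop k S i zero    ds       _                   _        = refl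
𝔼-anchor-drop k S i (suc j) (d ∷ ds) (mass≡1 ∷ masses≡1) (s≤s j≤) = begin
  𝔼 (independent (d ∷ ds)) (λ S′ → 𝟙 (anchor k S S′ i (suc (suc j))))
    ≡⟨ 𝔼-independent-∷ d ds _ ⟩
  𝔼 d (λ b → 𝔼 (independent ds) (λ w → 𝟙 (anchor k S (b ∷ w) i (suc (suc j)))))
    ≡⟨ 𝔼-cong d (λ b → 𝔼-cong (independent ds) (λ w → cong 𝟙 (anchor-∷ k S b w i j))) ⟩
  𝔼 d (λ _ → 𝔼 (independent ds) (λ w → 𝟙 (anchor k S w i (suc j))))
    ≡⟨ 𝔼-const-normalised d mass≡1 ⟩
  𝔼 (independent ds) (λ w → 𝟙 (anchor k S w i (suc j)))
    ≡⟨ 𝔼-anchor-drop k S i j ds masses≡1 j≤ ⟩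
  𝔼 (independent (drop j ds)) (λ S′ → 𝟙 (anchor k S S′ i 1))
    ∎

shiftOrigin : Origin → Origin
shiftOrigin inserted   = inserted
shiftOrigin (copyOf x) = copyOf (pred x)

shift : List (ℕ × Origin) → List (ℕ × Origin)
shift = map (Product.map pred shiftOrigin)

chain-shift : ∀ {lu lx} cs → OffDiagonalChain (suc lu) (suc lx) cs → OffDiagonalChain lu lx (shift cs)
chain-shift []                              _                                   = tt
chain-shift ((suc u , inserted) ∷ cs)       (s≤s lu≤ , chain)                   = lu≤ , chain-shift cs chain
chain-shift ((suc u , copyOf (suc x)) ∷ cs) (s≤s lu≤ , s≤s lx≤ , u≢x , chain) =
  lu≤ , lx≤ , u≢x ∘ cong suc , chain-shift cs chain

-- Averaging the comparisons over S

module _ (m : ℕ) (θs : ℚ) where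

  private
    σ : ℕ
    σ = suc (suc m)

  copied : Maybe (Fin σ) → Dist (Fin σ)
  copied (just a) = substitute σ θs a
  copied nothing  = uniform σ

  letterDist : List (Fin σ) → Origin → Dist (Fin σ)
  letterDist S inserted   = uniform σ
  letterDist S (copyOf x) = copied (at S x)

  mass-letterDist : ∀ S o → mass (letterDist S o) ≡ 1ℚ
  mass-letterDist S inserted   = mass-uniform (suc m)
  mass-letterDist S (copyOf x) with at S x
  ... | just a  = mass-substitute m θs a
  ... | nothing = mass-uniform (suc m)

  weight : List (Fin σ) → ℕ × Origin → ℚ
  weight S (u , o) = hit (letterDist S o) (at S u)

  ∏weight : List (Fin σ) → List (ℕ × Origin) → ℚ
  ∏weight S []       = 1ℚ
  ∏weight S (c ∷ cs) = weight S c Q.* ∏weight S cs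

  ∏weight-[] : ∀ cs → ∏weight [] cs ≡ inv σ ^ℚ length cs
  ∏weight-[] []       = refl
  ∏weight-[] (c ∷ cs) = cong (inv σ Q.*_) (∏weight-[] cs)

  ∏weight-shift : ∀ a w cs → OffDiagonalChain 2 2 cs → ∏weight (a ∷ w) cs ≡ ∏weight w (shift cs)
  ∏weight-shift a w []                                            _                   = refl
  ∏weight-shift a w ((suc (suc u) , inserted) ∷ cs)               (_ , chain)         =
    cong (weight w (suc u , inserted) Q.*_)
         (∏weight-shift a w cs (chain-weaken cs (s≤s (s≤s z≤n)) ℕP.≤-refl chain))
  ∏weight-shift a w ((suc (suc u) , copyOf (suc (suc x))) ∷ cs) (_ , _ , _ , chain) =
    cong (weight w (suc u , copyOf (suc x)) Q.*_)
         (∏weight-shift a w cs (chain-weaken cs (s≤s (s≤s z≤n)) (s≤s (s≤s z≤n)) chain))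
  ∏weight-shift a w ((suc zero , inserted) ∷ cs)                  (s≤s () , _)
  ∏weight-shift a w ((suc zero , copyOf x) ∷ cs)                  (s≤s () , _)
  ∏weight-shift a w ((suc (suc u) , copyOf (suc zero)) ∷ cs)      (_ , s≤s () , _)

  𝔼-∏weight : ∀ n cs → OffDiagonalChain 1 1 cs → 𝔼 (uniformString σ n) (λ S → ∏weight S cs) ≡ inv σ ^ℚ length cs
  𝔼-∏weight-shift : ∀ n cs → OffDiagonalChain 2 2 cs →
    𝔼 (uniformString σ n) (λ w → ∏weight w (shift cs)) ≡ inv σ ^ℚ length cs

  𝔼-∏weight-shift n cs chain =
    trans (𝔼-∏weight n (shift cs) (chain-shift cs chain)) (cong (inv σ ^ℚ_) (length-map _ cs))

  𝔼-∏weight zero    cs _ = trans (𝔼-return {List (Fin σ)} [] (λ S → ∏weight S cs)) (∏weight-[] cs)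
  𝔼-∏weight (suc n) []   _ = mass-uniformString (suc n)
  𝔼-∏weight (suc n) ((u , inserted) ∷ cs) (_ , chain) = begin
    𝔼 (uniformString σ (suc n)) (λ S → hit (uniform σ) (at S u) Q.* ∏weight S cs)
      ≡⟨ 𝔼-cong (uniformString σ (suc n)) (λ S → cong (Q._* ∏weight S cs) (hit-uniform (at S u))) ⟩
    𝔼 (uniformString σ (suc n)) (λ S → inv σ Q.* ∏weight S cs)
      ≡⟨ 𝔼-*ˡ (uniformString σ (suc n)) (inv σ) _ ⟩
    inv σ Q.* 𝔼 (uniformString σ (suc n)) (λ S → ∏weight S cs)
      ≡⟨ cong (inv σ Q.*_) (𝔼-∏weight (suc n) cs (chain-weaken cs (s≤s z≤n) ℕP.≤-refl chain)) ⟩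
    inv σ Q.* inv σ ^ℚ length cs
      ∎
  𝔼-∏weight (suc n) ((suc zero , copyOf (suc zero)) ∷ cs) (_ , _ , u≢x , _) = contradiction refl u≢x
  𝔼-∏weight (suc n) ((suc zero , copyOf (suc (suc x))) ∷ cs) (_ , _ , _ , chain) =
    trans (𝔼-uniformString-peel n (λ a w → hit (letterDist w (copyOf (suc x))) (just a)) (λ w → ∏weight w (shift cs))
             (λ a w → cong (hit (letterDist w (copyOf (suc x))) (just a) Q.*_) (∏weight-shift a w cs chain₂))
             (λ w → 𝔼-uniform-hit (letterDist w (copyOf (suc x))) (mass-letterDist w (copyOf (suc x)))))
          (cong (inv σ Q.*_) (𝔼-∏weight-shift n cs chain₂))
    where
    chain₂ : OffDiagonalChain 2 2 cs
    chain₂ = chain-weaken cs ℕP.≤-refl (s≤s (s≤s z≤n)) chain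
  𝔼-∏weight (suc n) ((suc (suc u) , copyOf (suc zero)) ∷ cs) (_ , _ , _ , chain) =
    trans (𝔼-uniformString-peel n (λ a w → hit (substitute σ θs a) (at w (suc u))) (λ w → ∏weight w (shift cs))
             (λ a w → cong (hit (substitute σ θs a) (at w (suc u)) Q.*_) (∏weight-shift a w cs chain₂))
             (λ w → 𝔼-uniform-hit-substitute m θs (at w (suc u))))
          (cong (inv σ Q.*_) (𝔼-∏weight-shift n cs chain₂))
    where
    chain₂ : OffDiagonalChain 2 2 cs
    chain₂ = chain-weaken cs (s≤s (s≤s z≤n)) ℕP.≤-refl chain
  𝔼-∏weight (suc n) cs@((suc (suc u) , copyOf (suc (suc x))) ∷ _) (_ , _ , u≢x , chain) =
    trans (𝔼-uniformString-tail n (λ w → ∏weight w (shift cs)) (λ a w → ∏weight-shift a w cs chain₂))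
          (𝔼-∏weight-shift n cs chain₂)
    where
    chain₂ : OffDiagonalChain 2 2 cs
    chain₂ = s≤s (s≤s z≤n) , s≤s (s≤s z≤n) , u≢x , chain

  𝔼-kept : ∀ S x del ins {a} → at S (suc x) ≡ just a → (g : List (Fin σ) → ℚ) →
    𝔼 (if del then return ins else emitAt σ θs ins (at S (suc x))) g
      ≡ 𝔼 (independent (map (letterDist S) (kept del x))) (λ e → g (ins ++ e))
  𝔼-kept S x true  ins _ g =
    trans (𝔼-return ins g) (sym (trans (𝔼-return {List (Fin σ)} [] (λ e → g (ins ++ e))) (cong g (++-identityʳ ins))))
  𝔼-kept S x false ins {a} S[1+x]≡a g rewrite S[1+x]≡a = begin
    𝔼 (substitute σ θs a >>= λ b → return (ins ++ b ∷ [])) g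
      ≡⟨ 𝔼->>= (substitute σ θs a) (λ b → return (ins ++ b ∷ [])) g ⟩
    𝔼 (substitute σ θs a) (λ b → 𝔼 (return (ins ++ b ∷ [])) g)
      ≡⟨ 𝔼-cong (substitute σ θs a) (λ b →
           trans (𝔼-return (ins ++ b ∷ []) g) (sym (𝔼-return {List (Fin σ)} [] (λ w → g (ins ++ b ∷ w))))) ⟩
    𝔼 (substitute σ θs a) (λ b → 𝔼 (return []) (λ w → g (ins ++ b ∷ w)))
      ≡⟨ sym (𝔼-independent-∷ (substitute σ θs a) [] _) ⟩
    𝔼 (independent (substitute σ θs a ∷ [])) (λ e → g (ins ++ e))
      ∎
  𝔼-channel : ∀ S x {k} (str : Vec (Bool × ℕ) k) → x + k ≤ length S → (f : List (Fin σ) → ℚ) →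
    𝔼 (channelFrom σ θs S x str) f ≡ 𝔼 (independent (map (letterDist S) (origins x str))) f
  𝔼-channel S x V.[]                 _    f = refl
  𝔼-channel S x {suc k} ((del , I) V.∷ rest) x+k≤ f = begin
    𝔼 (channelFrom σ θs S x ((del , I) V.∷ rest)) f
      ≡⟨ 𝔼->>= (uniformString σ I) _ f ⟩
    𝔼 (uniformString σ I) (λ ins → 𝔼 (emitted ins >>= λ h → following >>= λ t → return (h ++ t)) f)
      ≡⟨ 𝔼-cong (uniformString σ I) (λ ins → 𝔼-sequence (emitted ins) (λ _ → following) _++_ f) ⟩
    𝔼 (uniformString σ I) (λ ins → 𝔼 (emitted ins) (λ h → 𝔼 following (λ t → f (h ++ t))))
      ≡⟨ cong (λ d → 𝔼 d (λ ins → 𝔼 (emitted ins) (λ h → 𝔼 following (λ t → f (h ++ t)))))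
              (uniformString≡independent σ I) ⟩
    𝔼 (independent Is) (λ ins → 𝔼 (emitted ins) (λ h → 𝔼 following (λ t → f (h ++ t))))
      ≡⟨ 𝔼-cong (independent Is) (λ ins → 𝔼-kept S x del ins (proj₂ S[1+x]) _) ⟩
    𝔼 (independent Is) (λ ins → 𝔼 (independent Ks) (λ e → 𝔼 following (λ t → f ((ins ++ e) ++ t))))
      ≡⟨ 𝔼-cong (independent Is) (λ ins → 𝔼-cong (independent Ks) (λ e →
           trans (𝔼-channel S (suc x) rest 1+x+k≤ _) (𝔼-cong (independent Rs) (λ t → cong f (++-assoc ins e t))))) ⟩
    𝔼 (independent Is) (λ ins → 𝔼 (independent Ks) (λ e → 𝔼 (independent Rs) (λ t → f (ins ++ (e ++ t)))))
      ≡⟨ 𝔼-cong (independent Is) (λ ins → sym (𝔼-independent-++ Ks Rs (λ t → f (ins ++ t)))) ⟩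
    𝔼 (independent Is) (λ ins → 𝔼 (independent (Ks ++ Rs)) (λ t → f (ins ++ t)))
      ≡⟨ sym (𝔼-independent-++ Is (Ks ++ Rs) f) ⟩
    𝔼 (independent (Is ++ (Ks ++ Rs))) f
      ≡⟨ cong (λ ds → 𝔼 (independent ds) f) (sym letters) ⟩
    𝔼 (independent (map (letterDist S) (origins x ((del , I) V.∷ rest)))) f
      ∎
    where
    emitted : List (Fin σ) → Dist (List (Fin σ))
    emitted ins = if del then return ins else emitAt σ θs ins (at S (suc x))
    following : Dist (List (Fin σ))
    following = channelFrom σ θs S (suc x) rest
    Is Ks Rs : List (Dist (Fin σ))
    Is = replicate I (uniform σ)
    Ks = map (letterDist S) (kept del x)
    Rs = map (letterDist S) (origins (suc x) rest)
    1+x+k≤ : suc x + k ≤ length S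
    1+x+k≤ = subst (_≤ length S) (ℕP.+-suc x k) x+k≤
    S[1+x] = at-just S (suc x) (s≤s z≤n) (ℕP.m+n≤o⇒m≤o (suc x) 1+x+k≤)
    letters : map (letterDist S) (origins x ((del , I) V.∷ rest)) ≡ Is ++ (Ks ++ Rs)
    letters = begin
      map (letterDist S) (replicate I inserted ++ (kept del x ++ origins (suc x) rest))
        ≡⟨ map-++ (letterDist S) (replicate I inserted) _ ⟩
      map (letterDist S) (replicate I inserted) ++ map (letterDist S) (kept del x ++ origins (suc x) rest)
        ≡⟨ cong₂ _++_ (map-replicate (letterDist S) I inserted) (map-++ (letterDist S) (kept del x) _) ⟩
      Is ++ (Ks ++ Rs) ∎

  masses-letterDist : ∀ S os → All (λ d → mass d ≡ 1ℚ) (map (letterDist S) os)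
  masses-letterDist S os = All.map⁺ (All.universal (mass-letterDist S) os)

  𝔼-anchor : ∀ S k i os → 1 ≤ i → i + k ≤ suc (length S) → k ≤ length os →
    𝔼 (independent (map (letterDist S) os)) (λ S′ → 𝟙 (anchor k S S′ i 1)) ≡ ∏weight S (comparisons i (take k os))
  𝔼-anchor S zero    i os       _   _    _        = mass-independent _ (masses-letterDist S os)
  𝔼-anchor S (suc k) i (o ∷ os) 1≤i i+k≤ (s≤s k≤) = begin
    𝔼 (independent (d ∷ ds)) (λ S′ → 𝟙 (anchor (suc k) S S′ i 1))
      ≡⟨ 𝔼-independent-∷ d ds _ ⟩
    𝔼 d (λ b → 𝔼 (independent ds) (λ w → 𝟙 (sameAt (at S i) (just b) ∧ anchor k S (b ∷ w) (suc i) 2)))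
      ≡⟨ 𝔼-cong d (λ b → 𝔼-cong (independent ds) (λ w →
           trans (cong (λ z → 𝟙 (sameAt (at S i) (just b) ∧ z)) (anchor-∷ k S b w (suc i) 0))
                 (𝟙-∧ (sameAt (at S i) (just b)) (anchor k S w (suc i) 1)))) ⟩
    𝔼 d (λ b → 𝔼 (independent ds) (λ w → 𝟙 (sameAt (at S i) (just b)) Q.* 𝟙 (anchor k S w (suc i) 1)))
      ≡⟨ 𝔼-cong d (λ b → 𝔼-*ˡ (independent ds) (𝟙 (sameAt (at S i) (just b))) _) ⟩
    𝔼 d (λ b → 𝟙 (sameAt (at S i) (just b)) Q.* rest)
      ≡⟨ 𝔼-*ʳ d rest _ ⟩
    𝔼 d (λ b → 𝟙 (sameAt (at S i) (just b))) Q.* rest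
      ≡⟨ cong₂ Q._*_ match (𝔼-anchor S k (suc i) os (s≤s z≤n) 1+i+k≤ k≤) ⟩
    weight S (i , o) Q.* ∏weight S (comparisons (suc i) (take k os))
      ∎
    where
    d = letterDist S o
    ds = map (letterDist S) os
    rest = 𝔼 (independent ds) (λ w → 𝟙 (anchor k S w (suc i) 1))
    1+i+k≤ : suc i + k ≤ suc (length S)
    1+i+k≤ = subst (_≤ suc (length S)) (ℕP.+-suc i k) i+k≤
    S[i] = at-just S i 1≤i (ℕP.m+n≤o⇒m≤o i (ℕP.≤-pred 1+i+k≤))
    match : 𝔼 d (λ b → 𝟙 (sameAt (at S i) (just b))) ≡ hit d (at S i)
    match rewrite proj₂ S[i] = refl

  𝔼-anchor-channel : ∀ p {m′} (str : IndelStructure m′) S k i j → p + m′ ≤ length S →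
    1 ≤ i → i + k ≤ suc (length S) → j + k ≤ lengthS' str →
    𝔼 (channelFrom σ θs S p str) (λ S′ → 𝟙 (anchor k S S′ i (suc j))) ≡ ∏weight S (anchorComparisons p str i j k)
  𝔼-anchor-channel p str S k i j p+m′≤ 1≤i i+k≤ j+k≤ = begin
    𝔼 (channelFrom σ θs S p str) (λ S′ → 𝟙 (anchor k S S′ i (suc j)))
      ≡⟨ 𝔼-channel S p str p+m′≤ _ ⟩
    𝔼 (independent (map (letterDist S) os)) (λ S′ → 𝟙 (anchor k S S′ i (suc j)))
      ≡⟨ 𝔼-anchor-drop k S i j _ (masses-letterDist S os)
           (subst (j ≤_) (sym (length-map _ os)) (ℕP.m+n≤o⇒m≤o j j+k≤′)) ⟩
    𝔼 (independent (drop j (map (letterDist S) os))) (λ S′ → 𝟙 (anchor k S S′ i 1))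
      ≡⟨ cong (λ ds → 𝔼 (independent ds) (λ S′ → 𝟙 (anchor k S S′ i 1))) (drop-map j os) ⟩
    𝔼 (independent (map (letterDist S) (drop j os))) (λ S′ → 𝟙 (anchor k S S′ i 1))
      ≡⟨ 𝔼-anchor S k i (drop j os) 1≤i i+k≤ (≤-length-drop j k os j+k≤′) ⟩
    ∏weight S (anchorComparisons p str i j k)
      ∎
    where
    os = origins p str
    j+k≤′ : j + k ≤ length os
    j+k≤′ = subst (j + k ≤_) (sym (length-origins p str)) j+k≤

Pr-experiment : ∀ σ n p θs {m′} (str : IndelStructure m′) (E : List (Fin σ) × List (Fin σ) → Bool) →
  Pr (experiment σ n p θs str) E
    ≡ 𝔼 (uniformString σ n) (λ S → 𝔼 (channelFrom σ θs S p str) (λ S′ → 𝟙 (E (S , S′))))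
Pr-experiment σ n p θs str E =
  trans (Pr≡𝔼 (experiment σ n p θs str) E)
        (𝔼-sequence (uniformString σ n) (λ S → channelFrom σ θs S p str) _,_ (𝟙 ∘ E))

corollary1 : (σ n p m' k : ℕ) (θs : ℚ) (str : IndelStructure m') (i j : ℕ) →
    2 ≤ σ → 0ℚ Q.≤ θs → θs Q.≤ 1ℚ → p + m' ≤ n →
    1 ≤ i → i + k ≤ n + 1 → 1 ≤ j → j + k ≤ lengthS' str + 1 →
    (∀ l → l < k → (i + l , j + l) ∉ pathH p str) →
    Pr (experiment σ n p θs str) (λ SS' → anchor k (proj₁ SS') (proj₂ SS') i j) ≡ inv (σ ^ k)
corollary1 σ@(suc (suc m)) n p m' k θs str i (suc j) (s≤s (s≤s z≤n)) _ _ p+m'≤n 1≤i i+k≤n+1 _ 1+j+k≤ off-path = begin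
  Pr (experiment σ n p θs str) (λ SS' → anchor k (proj₁ SS') (proj₂ SS') i (suc j))
    ≡⟨ Pr-experiment σ n p θs str _ ⟩
  𝔼 (uniformString σ n) (λ S → 𝔼 (channelFrom σ θs S p str) (λ S′ → 𝟙 (anchor k S S′ i (suc j))))
    ≡⟨ 𝔼-uniformString-cong n (λ S ∣S∣≡n → 𝔼-anchor-channel m θs p str S k i j
         (subst (p + m' ≤_) (sym ∣S∣≡n) p+m'≤n) 1≤i
         (subst (i + k ≤_) (trans (ℕP.+-comm n 1) (cong suc (sym ∣S∣≡n))) i+k≤n+1) j+k≤) ⟩
  𝔼 (uniformString σ n) (λ S → ∏weight m θs S cs)
    ≡⟨ 𝔼-∏weight m θs n cs (chain-anchorComparisons p str i j k 1≤i off-path) ⟩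
  inv σ ^ℚ length cs
    ≡⟨ cong (inv σ ^ℚ_) (length-anchorComparisons p str i j k j+k≤) ⟩
  inv σ ^ℚ k
    ≡⟨ sym (inv-^ σ k) ⟩
  inv (σ ^ k)
    ∎
  where
  cs = anchorComparisons p str i j k
  j+k≤ : j + k ≤ lengthS' str
  j+k≤ = ℕP.≤-pred (subst (suc (j + k) ≤_) (ℕP.+-comm (lengthS' str) 1) 1+j+k≤)
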